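{- For each first-order insertion query $\rho(\bar p)$ for the edge relation $E$ there is a constant $m\in\mathbb N$ such that for each undirected graph $G$, each change $\delta=\rho(\bar a)$ and all nodes $u,v$ of $G$ that are connected in $\delta(G)$, it holds that $\mathrm{bd}(u,v)\le m$.
   Context: Graphs are structures with one binary relation $E$; undirected graphs have symmetric $E$. A first-order insertion query $\rho(\bar p)$ for $E$ is given by a formula $\mu(\bar p;x,y)=E(x,y)\lor\varphi(\bar p,x,y)$ with $\varphi$ first-order over $\{E\}$; for a tuple $\bar a$ of nodes, the change $\delta=\rho(\bar a)$ maps $G$ to the graph $\delta(G)$ on the same nodes with edge set $\{(b,c)\mid G\models\mu(\bar a;b,c)\}$. For nodes $u,v$ connected in $\delta(G)$, the bridge distance $\mathrm{bd}(u,v)$ is the minimal number $d$ such that there is a path from $u$ to $v$ in $\delta(G)$ that uses $d$ edges which are newly inserted by $\delta$ (i.e. edges of $\delta(G)$ not in $G$). -}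

module Defs where

open import Data.Nat using (ℕ; zero; suc)
open import Data.Fin using (Fin; zero; suc)
open import Data.Bool using (Bool; true; false)
open import Data.Product using (Σ; _×_; _,_; ∃)
open import Data.Sum using (_⊎_)
open import Data.Empty using (⊥)
open import Data.Unit using (⊤)
open import Relation.Nullary using (¬_)
open import Relation.Binary.PropositionalEquality using (_≡_)

record Graph : Set where
  field
    size : ℕ
    E    : Fin size → Fin size → Bool

open Graph public

Node : Graph → Set
Node G = Fin (size G)

Edge : (G : Graph) → Node G → Node G → Set
Edge G x y = E G x y ≡ true

Undirected : Graph → Set
Undirected G = ∀ x y → E G x y ≡ E G y x

-- First-order formulas over the vocabulary {E} (with equality),
-- free variables given as de Bruijn indices in Fin k.
data Formula (k : ℕ) : Set where
  edge  : Fin k → Fin k → Formula k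
  equal : Fin k → Fin k → Formula k
  ff    : Formula k
  tt    : Formula k
  ¬f_   : Formula k → Formula k
  _∧f_  : Formula k → Formula k → Formula k
  _∨f_  : Formula k → Formula k → Formula k
  _⇒f_  : Formula k → Formula k → Formula k
  ∃f    : Formula (suc k) → Formula k
  ∀f    : Formula (suc k) → Formula k

extend : {A : Set} {k : ℕ} → A → (Fin k → A) → Fin (suc k) → A
extend a ρ zero    = a
extend a ρ (suc i) = ρ i

Sat : (G : Graph) {k : ℕ} → Formula k → (Fin k → Node G) → Set
Sat G (edge i j)  ρ = Edge G (ρ i) (ρ j)
Sat G (equal i j) ρ = ρ i ≡ ρ j
Sat G ff          ρ = ⊥
Sat G tt          ρ = ⊤
Sat G (¬f φ)      ρ = ¬ Sat G φ ρ
Sat G (φ ∧f ψ)    ρ = Sat G φ ρ × Sat G ψ ρ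
Sat G (φ ∨f ψ)    ρ = Sat G φ ρ ⊎ Sat G ψ ρ
Sat G (φ ⇒f ψ)    ρ = Sat G φ ρ → Sat G ψ ρ
Sat G (∃f φ)      ρ = Σ (Node G) λ a → Sat G φ (extend a ρ)
Sat G (∀f φ)      ρ = (a : Node G) → Sat G φ (extend a ρ)

-- A first-order insertion query ρ(p̄) with k parameters p̄ is given by
-- φ(p̄,x,y) : Formula (suc (suc k)), where variable zero is x,
-- variable (suc zero) is y and variable (suc (suc i)) is p_i;
-- μ(p̄;x,y) = E(x,y) ∨ φ(p̄,x,y).
InsertionQuery : ℕ → Set
InsertionQuery k = Formula (suc (suc k))

ChangedEdge : {k : ℕ} (φ : InsertionQuery k) (G : Graph) (ā : Fin k → Node G)
            → Node G → Node G → Set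
ChangedEdge φ G ā b c = Edge G b c ⊎ Sat G φ (extend b (extend c ā))

-- BridgePath φ G ā u v d : a path from u to v in δ(G) (δ = ρ(ā)) that uses
-- exactly d edges newly inserted by δ (edges of δ(G) not in G).
data BridgePath {k : ℕ} (φ : InsertionQuery k) (G : Graph) (ā : Fin k → Node G)
     : Node G → Node G → ℕ → Set where
  stop   : ∀ {u} → BridgePath φ G ā u u zero
  oldE   : ∀ {u w v d} → Edge G u w
         → BridgePath φ G ā w v d → BridgePath φ G ā u v d
  newE   : ∀ {u w v d} → ChangedEdge φ G ā u w → ¬ Edge G u w
         → BridgePath φ G ā w v d → BridgePath φ G ā u v (suc d)

ConnectedIn : {k : ℕ} (φ : InsertionQuery k) (G : Graph) (ā : Fin k → Node G)
            → Node G → Node G → Set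
ConnectedIn φ G ā u v = ∃ λ d → BridgePath φ G ā u v d

module Submission where

-- Let q = rank φ.  Cut a path of δ(G) with d bridges (inserted edges) into
-- segments, each running inside one connected component of G.  Label a segment
-- end b by the set of parameters lying in its component and by the rank-q type
-- of b relative to its component (quantifiers range over that component only).
-- There are at most M labels, M depending only on k and q.  If d > M, either a
-- later segment re-enters the component of an earlier one, and the bridges in
-- between can be skipped; or two segment ends e i, e j (i < j) carry the same
-- label, hence lie in distinct parameter-free components of the same type.
-- An Ehrenfeucht–Fraïssé argument (exchanging the two components) then shows
-- that the bridge leaving e j is also inserted at e i, again skipping bridges.
-- By well-founded induction every path shrinks to one with at most M bridges.

open import Defs
open import Data.Bool using (Bool; true; false)
open import Data.Bool.Properties using () renaming (_≟_ to _≟ᵇ_)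
open import Data.Empty using (⊥-elim)
open import Data.Fin using (Fin; zero; suc; combine; toℕ)
open import Data.Fin.Properties using (any?; combine-injective; pigeonhole; toℕ<n) renaming (_≟_ to _≟ᶠ_)
open import Data.Fin.Subset using (Subset; _∈_; _∉_; _⊆_; _∪_; ⁅_⁆; ∣_∣)
open import Data.Fin.Subset.Properties
  using (_∈?_; ∣p∣≤n; ∣⁅x⁆∣≡1; x∈⁅x⁆; x∈⁅y⁆⇒x≡y; p⊆p∪q; x∈p∪q⁺; x∈p∪q⁻; p⊂q⇒∣p∣<∣q∣)
open import Data.Nat using (ℕ; zero; suc; _*_; _^_; _+_; _∸_; _≤_; _<_; z≤n; s≤s; _≤?_)
open import Data.Nat.Induction using (<-rec)
open import Data.Nat.Properties
  using (≤-refl; ≤-trans; ≤-reflexive; <-≤-trans; <⇒≤; <⇒≱; ≰⇒>; m<n⇒m<1+n; n<1+n; m≤n+m;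
         +-identityʳ; +-suc; +-assoc; +-comm; +-monoˡ-≤; +-monoˡ-<; m+n≤o⇒m≤o; m+n≤o⇒n≤o; m+[n∸m]≡n;
         anyUpTo?; module ≤-Reasoning)
open import Data.Product using (∃; _×_; _,_; proj₁; proj₂)
open import Data.Sum using (inj₁; inj₂)
open import Data.Vec using (Vec; []; _∷_; lookup; tabulate)
open import Data.Vec.Properties using (lookup∘tabulate)
open import Function using (id; _∘_)
open import Relation.Binary.Construct.Closure.ReflexiveTransitive using (Star; ε; _◅_; _◅◅_; reverse)
open import Relation.Binary.PropositionalEquality
open import Relation.Nullary using (Dec; yes; no; does; ¬_; ¬?)
open import Relation.Nullary.Decidable using (dec-true; _×-dec_)

private variable
  A B : Set
  r : ℕ

witness : ∀ {P : Set} (P? : Dec P) → does P? ≡ true → P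
witness (yes p) _ = p

record Finite (A : Set) : Set where
  field
    bound          : ℕ
    code           : A → Fin bound
    code-injective : ∀ {a b} → code a ≡ code b → a ≡ b
open Finite

bool-finite : Finite Bool
bool-finite = record { bound = 2 ; code = code′ ; code-injective = injective }
  where
  code′ : Bool → Fin 2
  code′ true  = zero
  code′ false = suc zero
  injective : ∀ {a b} → code′ a ≡ code′ b → a ≡ b
  injective {true}  {true}  _ = refl
  injective {false} {false} _ = refl

×-finite : Finite A → Finite B → Finite (A × B)
×-finite {A} {B} FA FB = record { bound = bound FA * bound FB ; code = code′ ; code-injective = injective }
  where
  code′ : A × B → Fin (bound FA * bound FB)
  code′ (a , b) = combine (code FA a) (code FB b)
  injective : ∀ {p q} → code′ p ≡ code′ q → p ≡ q
  injective {a , b} {a′ , b′} eq =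
    let (ca , cb) = combine-injective (code FA a) (code FB b) (code FA a′) (code FB b′) eq
    in cong₂ _,_ (code-injective FA ca) (code-injective FB cb)

vec-finite : Finite A → ∀ m → Finite (Vec A m)
vec-finite {A} FA m = record { bound = bound FA ^ m ; code = code′ ; code-injective = injective }
  where
  code′ : ∀ {m} → Vec A m → Fin (bound FA ^ m)
  code′ []       = zero
  code′ (a ∷ v) = combine (code FA a) (code′ v)
  injective : ∀ {m} {v w : Vec A m} → code′ v ≡ code′ w → v ≡ w
  injective {v = []}    {[]}    _  = refl
  injective {v = a ∷ v} {b ∷ w} eq =
    let (ca , cv) = combine-injective (code FA a) (code′ v) (code FA b) (code′ w) eq
    in cong₂ _∷_ (code-injective FA ca) (injective cv)

-- Rank-0 type of an r-tuple: for each pair of positions, adjacency and equality.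
AtomicType : ℕ → Set
AtomicType r = Vec (Vec (Bool × Bool) r) r

-- Rank-(q+1) type: the rank-q type together with the set of rank-q types
-- of all one-element extensions, as a subset of the codes of such types.
mutual
  Type : ℕ → ℕ → Set
  Type zero    r = AtomicType r
  Type (suc q) r = Type q r × Subset (bound (type-finite q (suc r)))

  type-finite : ∀ q r → Finite (Type q r)
  type-finite zero    r = vec-finite (vec-finite (×-finite bool-finite bool-finite) r) r
  type-finite (suc q) r = ×-finite (type-finite q r) (vec-finite bool-finite _)

module Types (G : Graph) where

  atomic : (Fin r → Node G) → AtomicType r
  atomic x = tabulate λ i → tabulate λ j → E G (x i) (x j) , does (x i ≟ᶠ x j)

  mutual
    -- tp X q x: the rank-q type of the tuple x when quantifiers range over
    -- the region X only.
    tp : Subset (size G) → (q : ℕ) → (Fin r → Node G) → Type q r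
    tp X zero    x = atomic x
    tp X (suc q) x = tp X q x , tabulate (λ c → does (realizes? X q x c))

    Realizes : Subset (size G) → (q : ℕ) → (Fin r → Node G) → Fin (bound (type-finite q (suc r))) → Set
    Realizes X q x c = ∃ λ a → a ∈ X × code (type-finite q _) (tp X q (extend a x)) ≡ c

    realizes? : ∀ X q (x : Fin r → Node G) c → Dec (Realizes X q x c)
    realizes? X q x c = any? λ a → (a ∈? X) ×-dec (code (type-finite q _) (tp X q (extend a x)) ≟ᶠ c)

  realized-entry : ∀ X q (x : Fin r → Node G) c → lookup (proj₂ (tp X (suc q) x)) c ≡ does (realizes? X q x c)
  realized-entry X q x c = lookup∘tabulate (λ c → does (realizes? X q x c)) c

  realizes-transport : ∀ {X Y q} {x y : Fin r → Node G} → tp X (suc q) x ≡ tp Y (suc q) y →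
                       ∀ {c} → Realizes X q x c → Realizes Y q y c
  realizes-transport {X = X} {Y} {q} {x} {y} eq {c} realized = witness (realizes? Y q y c) (begin
    does (realizes? Y q y c)            ≡⟨ realized-entry Y q y c ⟨
    lookup (proj₂ (tp Y (suc q) y)) c   ≡⟨ cong (λ t → lookup (proj₂ t) c) eq ⟨
    lookup (proj₂ (tp X (suc q) x)) c   ≡⟨ realized-entry X q x c ⟩
    does (realizes? X q x c)            ≡⟨ dec-true (realizes? X q x c) realized ⟩
    true                                ∎)
    where open ≡-Reasoning

  ⟨_⟩ : Node G → Fin 1 → Node G
  ⟨ a ⟩ _ = a

  tp-forth : ∀ {X Y q} {x y : Fin r → Node G} → tp X (suc q) x ≡ tp Y (suc q) y →
             ∀ {a} → a ∈ X → ∃ λ b → b ∈ Y × tp X q (extend a x) ≡ tp Y q (extend b y)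
  tp-forth {q = q} eq a∈X =
    let (b , b∈Y , same-code) = realizes-transport eq (_ , a∈X , refl)
    in b , b∈Y , sym (code-injective (type-finite q _) same-code)

  tp-atomic : ∀ {X Y} q {x y : Fin r → Node G} → tp X q x ≡ tp Y q y → atomic x ≡ atomic y
  tp-atomic zero    eq = eq
  tp-atomic (suc q) eq = tp-atomic q (cong proj₁ eq)

  atomic-entry : ∀ (x : Fin r → Node G) i j → lookup (lookup (atomic x) i) j ≡ (E G (x i) (x j) , does (x i ≟ᶠ x j))
  atomic-entry x i j = begin
    lookup (lookup (atomic x) i) j ≡⟨ cong (λ row → lookup row j) (lookup∘tabulate _ i) ⟩
    lookup (tabulate (λ j → E G (x i) (x j) , does (x i ≟ᶠ x j))) j ≡⟨ lookup∘tabulate _ j ⟩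
    (E G (x i) (x j) , does (x i ≟ᶠ x j)) ∎
    where open ≡-Reasoning

  atomic-≡-entry : ∀ {x y : Fin r → Node G} → atomic x ≡ atomic y → ∀ i j →
                   (E G (x i) (x j) , does (x i ≟ᶠ x j)) ≡ (E G (y i) (y j) , does (y i ≟ᶠ y j))
  atomic-≡-entry {x = x} {y} eq i j =
    trans (sym (atomic-entry x i j)) (trans (cong (λ t → lookup (lookup t i) j) eq) (atomic-entry y i j))

  atomic-edge : ∀ {x y : Fin r → Node G} → atomic x ≡ atomic y → ∀ i j → Edge G (x i) (x j) → Edge G (y i) (y j)
  atomic-edge {x = x} {y} eq i j e = trans (sym (cong proj₁ (atomic-≡-entry eq i j))) e

  atomic-equal : ∀ {x y : Fin r → Node G} → atomic x ≡ atomic y → ∀ i j → x i ≡ x j → y i ≡ y j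
  atomic-equal {x = x} {y} eq i j e = witness (y i ≟ᶠ y j) (trans (sym (cong proj₂ (atomic-≡-entry eq i j))) (dec-true (x i ≟ᶠ x j) e))

module Components (G : Graph) (undirected : Undirected G) where

  Reach : Node G → Node G → Set
  Reach = Star (Edge G)

  edge-sym : ∀ {a b} → Edge G a b → Edge G b a
  edge-sym {a} {b} e = trans (undirected b a) e

  reach-sym : ∀ {a b} → Reach a b → Reach b a
  reach-sym = reverse edge-sym

  Closed : Subset (size G) → Set
  Closed S = ∀ {a b} → a ∈ S → Edge G a b → b ∈ S

  closed-reach : ∀ {S a b} → Closed S → a ∈ S → Reach a b → b ∈ S
  closed-reach closed a∈S ε        = a∈S
  closed-reach closed a∈S (e ◅ r) = closed-reach closed (closed a∈S e) r

  record Hull (S : Subset (size G)) (P : Node G → Set) : Set where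
    constructor hull
    field
      set       : Subset (size G)
      contains  : S ⊆ set
      closed    : Closed set
      satisfies : ∀ {a} → a ∈ set → P a

  -- Each step
  -- enlarges S, so fuel with  size G < ∣ S ∣ + fuel  suffices.
  saturate : (P : Node G → Set) → (∀ {a b} → P a → Edge G a b → P b) →
             (fuel : ℕ) (S : Subset (size G)) → size G < ∣ S ∣ + fuel → (∀ {a} → a ∈ S → P a) → Hull S P
  saturate P P-closed zero S small _ = ⊥-elim (<⇒≱ small (≤-trans (≤-reflexive (+-identityʳ ∣ S ∣)) (∣p∣≤n S)))
  saturate P P-closed (suc fuel) S small S⊆P
    with any? (λ a → any? (λ b → (a ∈? S) ×-dec (¬? (b ∈? S)) ×-dec (E G a b ≟ᵇ true)))
  ... | no no-exit = hull S id closed S⊆P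
    where
    closed : Closed S
    closed {a} {b} a∈S e with b ∈? S
    ... | yes b∈S = b∈S
    ... | no  b∉S = ⊥-elim (no-exit (a , b , a∈S , b∉S , e))
  ... | yes (a , b , a∈S , b∉S , e) =
    let hull S′ S∪b⊆S′ closed S′⊆P = saturate P P-closed fuel S∪b smaller S∪b⊆P
    in hull S′ (S∪b⊆S′ ∘ p⊆p∪q ⁅ b ⁆) closed S′⊆P
    where
    S∪b = S ∪ ⁅ b ⁆
    grows : ∣ S ∣ < ∣ S∪b ∣
    grows = p⊂q⇒∣p∣<∣q∣ (p⊆p∪q ⁅ b ⁆ , b , x∈p∪q⁺ (inj₂ (x∈⁅x⁆ b)) , b∉S)
    smaller : size G < ∣ S∪b ∣ + fuel
    smaller = <-≤-trans (subst (size G <_) (+-suc ∣ S ∣ fuel) small) (+-monoˡ-≤ fuel grows)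
    S∪b⊆P : ∀ {c} → c ∈ S∪b → P c
    S∪b⊆P c∈ with x∈p∪q⁻ S ⁅ b ⁆ c∈
    ... | inj₁ c∈S = S⊆P c∈S
    ... | inj₂ c∈b rewrite x∈⁅y⁆⇒x≡y b c∈b = P-closed (S⊆P a∈S) e

  component-hull : ∀ b → Hull ⁅ b ⁆ (Reach b)
  component-hull b = saturate (Reach b) (λ r e → r ◅◅ (e ◅ ε)) (size G) ⁅ b ⁆ small from-b
    where
    small : size G < ∣ ⁅ b ⁆ ∣ + size G
    small rewrite ∣⁅x⁆∣≡1 b = ≤-refl
    from-b : ∀ {a} → a ∈ ⁅ b ⁆ → Reach b a
    from-b a∈b rewrite x∈⁅y⁆⇒x≡y b a∈b = ε

  component : Node G → Subset (size G)
  component b = Hull.set (component-hull b)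

  ∈-component : ∀ b → b ∈ component b
  ∈-component b = Hull.contains (component-hull b) (x∈⁅x⁆ b)

  component-closed : ∀ b → Closed (component b)
  component-closed b = Hull.closed (component-hull b)

  component⇒reach : ∀ {b a} → a ∈ component b → Reach b a
  component⇒reach {b} = Hull.satisfies (component-hull b)

  reach⇒component : ∀ {b a} → Reach b a → a ∈ component b
  reach⇒component {b} = closed-reach (component-closed b) (∈-component b)

rank : ∀ {k} → Formula k → ℕ
rank (edge _ _)  = 0
rank (equal _ _) = 0
rank ff          = 0
rank tt          = 0
rank (¬f ψ)      = rank ψ
rank (ψ ∧f χ)    = rank ψ + rank χ
rank (ψ ∨f χ)    = rank ψ + rank χ
rank (ψ ⇒f χ)    = rank ψ + rank χ
rank (∃f ψ)      = suc (rank ψ)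
rank (∀f ψ)      = suc (rank ψ)

-- An Ehrenfeucht–Fraïssé argument for exchanging two closed regions.
module Transfer (G : Graph) (undirected : Undirected G) where
  open Types G
  open Components G undirected

  record Regions : Set where
    field
      X Y      : Subset (size G)
      X-closed : Closed X
      Y-closed : Closed Y
      disjoint : ∀ {a} → a ∈ X → a ∉ Y

  swap : Regions → Regions
  swap R = record { X = Y ; Y = X ; X-closed = Y-closed ; Y-closed = X-closed ; disjoint = λ a∈Y a∈X → disjoint a∈X a∈Y }
    where open Regions R

  record Match (Z W : Subset (size G)) (q : ℕ) {r} (s t : Fin r → Node G) : Set where
    constructor match
    field
      {len}  : ℕ
      x y    : Fin len → Node G
      types  : tp Z q x ≡ tp W q y
      covers : ∀ l → s l ∈ Z → ∃ λ p → x p ≡ s l × y p ≡ t l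

  record Agree {r} (s t : Fin r → Node G) (i j : Fin r) : Set where
    constructor agree
    field
      edge-agree  : Edge G (s i) (s j) → Edge G (t i) (t j)
      equal-agree : s i ≡ s j → t i ≡ t j

  match-agree : ∀ {Z W q r} {s t : Fin r → Node G} → Match Z W q s t → ∀ {i j} → s i ∈ Z → s j ∈ Z → Agree s t i j
  match-agree {q = q} (match x y types covers) {i} {j} i∈Z j∈Z
    with p , xp≡si , yp≡ti ← covers i i∈Z | p′ , xp′≡sj , yp′≡tj ← covers j j∈Z = agree
    (λ e → subst₂ (Edge G) yp≡ti yp′≡tj (atomic-edge same p p′ (subst₂ (Edge G) (sym xp≡si) (sym xp′≡sj) e)))
    (λ eq → trans (sym yp≡ti) (trans (atomic-equal same p p′ (trans xp≡si (trans eq (sym xp′≡sj)))) yp′≡tj))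
    where same = tp-atomic q types

  Unrelated : Node G → Node G → Set
  Unrelated a b = ¬ Edge G a b × a ≢ b

  apart : ∀ {Z a b} → Closed Z → a ∈ Z → b ∉ Z → Unrelated a b
  apart {Z} closed a∈Z b∉Z = (λ e → b∉Z (closed a∈Z e)) , (λ a≡b → b∉Z (subst (_∈ Z) a≡b a∈Z))

  apart′ : ∀ {Z a b} → Closed Z → a ∉ Z → b ∈ Z → Unrelated a b
  apart′ closed a∉Z b∈Z = let (no-edge , a≢b) = apart closed b∈Z a∉Z in no-edge ∘ edge-sym , a≢b ∘ sym

  vacuous : ∀ {r} {s t : Fin r → Node G} {i j} → Unrelated (s i) (s j) → Agree s t i j
  vacuous (no-edge , si≢sj) = agree (⊥-elim ∘ no-edge) (⊥-elim ∘ si≢sj)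

  module _ (R : Regions) where
    open Regions R

    data Position (a b : Node G) : Set where
      X→Y   : a ∈ X → b ∈ Y → Position a b
      Y→X   : a ∈ Y → b ∈ X → Position a b
      fixed : a ∉ X → a ∉ Y → a ≡ b → Position a b

    -- Correspondence R q s t: t arises from s by exchanging X and Y, with
    -- the two exchanged parts indistinguishable up to rank q.
    record Correspondence (q : ℕ) {r} (s t : Fin r → Node G) : Set where
      constructor correspondence
      field
        position : ∀ l → Position (s l) (t l)
        match-XY : Match X Y q s t
        match-YX : Match Y X q s t

    correspondence-agree : ∀ {q r} {s t : Fin r → Node G} → Correspondence q s t → ∀ i j → Agree s t i j
    correspondence-agree (correspondence position mXY mYX) i j with position i | position j
    ... | X→Y i∈X _     | X→Y j∈X _     = match-agree mXY i∈X j∈X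
    ... | Y→X i∈Y _     | Y→X j∈Y _     = match-agree mYX i∈Y j∈Y
    ... | fixed _ _ si≡ti | fixed _ _ sj≡tj = agree (subst₂ (Edge G) si≡ti sj≡tj) (λ eq → trans (sym si≡ti) (trans eq sj≡tj))
    ... | X→Y i∈X _     | Y→X j∈Y _     = vacuous (apart X-closed i∈X (λ j∈X → disjoint j∈X j∈Y))
    ... | X→Y i∈X _     | fixed j∉X _ _ = vacuous (apart X-closed i∈X j∉X)
    ... | Y→X i∈Y _     | X→Y j∈X _     = vacuous (apart Y-closed i∈Y (disjoint j∈X))
    ... | Y→X i∈Y _     | fixed _ j∉Y _ = vacuous (apart Y-closed i∈Y j∉Y)
    ... | fixed i∉X _ _ | X→Y j∈X _     = vacuous (apart′ X-closed i∉X j∈X)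
    ... | fixed _ i∉Y _ | Y→X j∈Y _     = vacuous (apart′ Y-closed i∉Y j∈Y)

  swap-match : ∀ {Z W q r} {s t : Fin r → Node G} → (∀ l → t l ∈ W → s l ∈ Z) → Match Z W q s t → Match W Z q t s
  swap-match back (match x y types covers) = match y x (sym types) λ l t∈W →
    let (p , xp≡sl , yp≡tl) = covers l (back l t∈W) in p , yp≡tl , xp≡sl

  swap-correspondence : ∀ R {q r} {s t : Fin r → Node G} → Correspondence R q s t → Correspondence (swap R) q t s
  swap-correspondence R {s = s} {t} (correspondence position mXY mYX) =
    correspondence swap-position (swap-match Y-back mXY) (swap-match X-back mYX)
    where
    open Regions R
    swap-position : ∀ l → Position (swap R) (t l) (s l)
    swap-position l with position l
    ... | X→Y sl∈X tl∈Y       = X→Y tl∈Y sl∈X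
    ... | Y→X sl∈Y tl∈X       = Y→X tl∈X sl∈Y
    ... | fixed sl∉X sl∉Y sl≡tl = fixed (subst (_∉ Y) sl≡tl sl∉Y) (subst (_∉ X) sl≡tl sl∉X) (sym sl≡tl)
    Y-back : ∀ l → t l ∈ Y → s l ∈ X
    Y-back l tl∈Y with position l
    ... | X→Y sl∈X _          = sl∈X
    ... | Y→X _ tl∈X          = ⊥-elim (disjoint tl∈X tl∈Y)
    ... | fixed _ sl∉Y sl≡tl  = ⊥-elim (sl∉Y (subst (_∈ Y) (sym sl≡tl) tl∈Y))
    X-back : ∀ l → t l ∈ X → s l ∈ Y
    X-back l tl∈X with position l
    ... | X→Y _ tl∈Y          = ⊥-elim (disjoint tl∈X tl∈Y)
    ... | Y→X sl∈Y _          = sl∈Y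
    ... | fixed sl∉X _ sl≡tl  = ⊥-elim (sl∉X (subst (_∈ X) (sym sl≡tl) tl∈X))

  match-skip : ∀ {Z W q r a b} {s t : Fin r → Node G} → a ∉ Z → Match Z W (suc q) s t →
               Match Z W q (extend a s) (extend b t)
  match-skip a∉Z (match x y types covers) = match x y (cong proj₁ types) λ
    { zero    a∈Z → ⊥-elim (a∉Z a∈Z)
    ; (suc l) sl∈Z → covers l sl∈Z }

  match-extend : ∀ {Z W q r a} {s t : Fin r → Node G} → a ∈ Z → Match Z W (suc q) s t →
                 ∃ λ b → b ∈ W × Match Z W q (extend a s) (extend b t)
  match-extend {a = a} a∈Z (match x y types covers) =
    let (b , b∈W , types′) = tp-forth types a∈Z
    in b , b∈W , match (extend a x) (extend b y) types′ λ
      { zero    _    → zero , refl , refl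
      ; (suc l) sl∈Z → let (p , xp≡sl , yp≡tl) = covers l sl∈Z in suc p , xp≡sl , yp≡tl }

  extend-position : ∀ {R r a b} {s t : Fin r → Node G} → Position R a b →
                    (∀ l → Position R (s l) (t l)) → ∀ l → Position R (extend a s l) (extend b t l)
  extend-position p _         zero    = p
  extend-position _ positions (suc l) = positions l

  correspondence-extend : ∀ R {q r} {s t : Fin r → Node G} → Correspondence R (suc q) s t →
                          ∀ a → ∃ λ b → Correspondence R q (extend a s) (extend b t)
  correspondence-extend R (correspondence position mXY mYX) a with a ∈? Regions.X R | a ∈? Regions.Y R
  ... | yes a∈X | _ = let (b , b∈Y , mXY′) = match-extend a∈X mXY in
    b , correspondence (extend-position (X→Y a∈X b∈Y) position) mXY′ (match-skip (Regions.disjoint R a∈X) mYX)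
  ... | no a∉X | yes a∈Y = let (b , b∈X , mYX′) = match-extend a∈Y mYX in
    b , correspondence (extend-position (Y→X a∈Y b∈X) position) (match-skip a∉X mXY) mYX′
  ... | no a∉X | no a∉Y =
    a , correspondence (extend-position (fixed a∉X a∉Y refl) position) (match-skip a∉X mXY) (match-skip a∉Y mYX)

  transfer : ∀ R {q r} (ψ : Formula r) → rank ψ ≤ q → ∀ {s t} → Correspondence R q s t → Sat G ψ s → Sat G ψ t
  transfer R (edge i j)  _ c = Agree.edge-agree (correspondence-agree R c i j)
  transfer R (equal i j) _ c = Agree.equal-agree (correspondence-agree R c i j)
  transfer R tt          _ c _ = _
  transfer R (¬f ψ)      h c ¬ψs ψt = ¬ψs (transfer (swap R) ψ h (swap-correspondence R c) ψt)
  transfer R (ψ ∧f χ)    h c (ψs , χs) = transfer R ψ (m+n≤o⇒m≤o _ h) c ψs , transfer R χ (m+n≤o⇒n≤o _ h) c χs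
  transfer R (ψ ∨f χ)    h c (inj₁ ψs) = inj₁ (transfer R ψ (m+n≤o⇒m≤o _ h) c ψs)
  transfer R (ψ ∨f χ)    h c (inj₂ χs) = inj₂ (transfer R χ (m+n≤o⇒n≤o _ h) c χs)
  transfer R (ψ ⇒f χ)    h c ψs→χs ψt =
    transfer R χ (m+n≤o⇒n≤o _ h) c (ψs→χs (transfer (swap R) ψ (m+n≤o⇒m≤o _ h) (swap-correspondence R c) ψt))
  transfer R {suc q} (∃f ψ) (s≤s h) c (a , ψsa) =
    let (b , c′) = correspondence-extend R c a in b , transfer R ψ h c′ ψsa
  transfer R {suc q} (∀f ψ) (s≤s h) c ψs b =
    let (a , c′) = correspondence-extend (swap R) (swap-correspondence R c) b
    in transfer R ψ h (swap-correspondence (swap R) c′) (ψs a)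

  component-exchange : ∀ {q r a b} (ψ : Formula (suc r)) (x̄ : Fin r → Node G) → rank ψ ≤ q →
    ¬ Reach a b → (∀ l → x̄ l ∉ component a) → (∀ l → x̄ l ∉ component b) →
    tp (component a) q ⟨ a ⟩ ≡ tp (component b) q ⟨ b ⟩ →
    Sat G ψ (extend a x̄) → Sat G ψ (extend b x̄)
  component-exchange {q} {a = a} {b} ψ x̄ h a↛b x̄∉A x̄∉B same-type =
    transfer R ψ h (correspondence position match-AB match-BA)
    where
    R : Regions
    R = record { X = component a ; Y = component b ; X-closed = component-closed a ; Y-closed = component-closed b
               ; disjoint = λ c∈A c∈B → a↛b (component⇒reach c∈A ◅◅ reach-sym (component⇒reach c∈B)) }
    position : ∀ l → Position R (extend a x̄ l) (extend b x̄ l)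
    position zero    = X→Y (∈-component a) (∈-component b)
    position (suc l) = fixed (x̄∉A l) (x̄∉B l) refl
    match-AB : Match (component a) (component b) q (extend a x̄) (extend b x̄)
    match-AB = match ⟨ a ⟩ ⟨ b ⟩ same-type λ
      { zero    _    → zero , refl , refl
      ; (suc l) x∈A → ⊥-elim (x̄∉A l x∈A) }
    match-BA : Match (component b) (component a) q (extend a x̄) (extend b x̄)
    match-BA = match ⟨ b ⟩ ⟨ a ⟩ (sym same-type) λ
      { zero    a∈B → ⊥-elim (a↛b (reach-sym (component⇒reach a∈B)))
      ; (suc l) x∈B → ⊥-elim (x̄∉B l x∈B) }

-- A node is labelled by the set of parameters in its component and by its
-- rank-q type relative to its component; there are finitely many labels.
Label : ℕ → ℕ → Set
Label k q = Subset k × Type q 1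

label-finite : ∀ k q → Finite (Label k q)
label-finite k q = ×-finite (vec-finite bool-finite k) (type-finite q 1)

-- The bound of the theorem: the number of labels for the query φ.
label-count : ∀ {k} → InsertionQuery k → ℕ
label-count {k} φ = bound (label-finite k (rank φ))

-- Skipping from segment i to segment j > c + i through c bridges saves bridges:
-- the new count  i + c + (d - j)  is below d.
shortcut-bound : ∀ {i j c d} → c + i < j → j ≤ d → i + (c + (d ∸ j)) < d
shortcut-bound {i} {j} {c} {d} c+i<j j≤d = begin-strict
  i + (c + (d ∸ j)) ≡⟨ +-assoc i c (d ∸ j) ⟨
  i + c + (d ∸ j)   ≡⟨ cong (_+ (d ∸ j)) (+-comm i c) ⟩
  c + i + (d ∸ j)   <⟨ +-monoˡ-< (d ∸ j) c+i<j ⟩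
  j + (d ∸ j)       ≡⟨ m+[n∸m]≡n j≤d ⟩
  d                 ∎
  where open ≤-Reasoning

module Bridges {k} (φ : InsertionQuery k) (G : Graph) (undirected : Undirected G) (ā : Fin k → Node G) where
  open Types G
  open Components G undirected
  open Transfer G undirected

  Path : Node G → Node G → ℕ → Set
  Path = BridgePath φ G ā

  append : ∀ {a b c d₁ d₂} → Path a b d₁ → Path b c d₂ → Path a c (d₁ + d₂)
  append stop             q = q
  append (oldE e p)       q = oldE e (append p q)
  append (newE e new p)   q = newE e new (append p q)

  Shorter : Node G → Node G → ℕ → Set
  Shorter u v d = ∃ λ d′ → d′ < d × Path u v d′

  Short : Node G → Node G → Set
  Short u v = ∃ λ d → d ≤ label-count φ × Path u v d

  reach-path : ∀ {a b} → Reach a b → Path a b 0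
  reach-path ε        = stop
  reach-path (e ◅ r) = oldE e (reach-path r)

  NewEdge : Node G → Node G → Set
  NewEdge b c = ChangedEdge φ G ā b c × ¬ Edge G b c

  -- A path with d bridges, cut at its bridges: segment i runs inside G from
  -- s i to e i, and bridge i leads from e i to s (i + 1).
  record Decomposition (u v : Node G) (d : ℕ) : Set where
    field
      s e     : ℕ → Node G
      s-zero  : s 0 ≡ u
      prefix  : ∀ {i} → i ≤ d → Path u (e i) i
      suffix  : ∀ {j} → j ≤ d → Path (s j) v (d ∸ j)
      segment : ∀ {i} → i ≤ d → Reach (s i) (e i)
      bridge  : ∀ {i} → i < d → NewEdge (e i) (s (suc i))

  decompose : ∀ {u v d} → Path u v d → Decomposition u v d
  decompose {u} stop = record
    { s = λ _ → u ; e = λ _ → u ; s-zero = refl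
    ; prefix = λ { z≤n → stop } ; suffix = λ { z≤n → stop } ; segment = λ _ → ε ; bridge = λ () }
  decompose {u} path@(oldE old rest) = record
    { s = λ { zero → u ; (suc i) → s (suc i) } ; e = e ; s-zero = refl
    ; prefix = oldE old ∘ prefix
    ; suffix = λ { {zero} _ → path ; {suc j} j≤d → suffix j≤d }
    ; segment = λ { {zero} _ → old ◅ subst (λ a → Reach a (e 0)) s-zero (segment z≤n) ; {suc i} i≤d → segment i≤d }
    ; bridge = bridge }
    where open Decomposition (decompose rest)
  decompose {u} path@(newE changed new rest) = record
    { s = λ { zero → u ; (suc i) → s i } ; e = λ { zero → u ; (suc i) → e i } ; s-zero = refl
    ; prefix = λ { {zero} _ → stop ; {suc i} (s≤s i≤d) → newE changed new (prefix i≤d) }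
    ; suffix = λ { {zero} _ → path ; {suc j} (s≤s j≤d) → suffix j≤d }
    ; segment = λ { {zero} _ → ε ; {suc i} (s≤s i≤d) → segment i≤d }
    ; bridge = λ { {zero} _ → subst (NewEdge u) (sym s-zero) (changed , new) ; {suc i} (s≤s i<d) → bridge i<d } }
    where open Decomposition (decompose rest)

  anchors : Node G → Subset k
  anchors b = tabulate λ p → does (ā p ∈? component b)

  label : Node G → Label k (rank φ)
  label b = anchors b , tp (component b) (rank φ) ⟨ b ⟩

  anchors-transport : ∀ {a b p} → anchors a ≡ anchors b → ā p ∈ component a → ā p ∈ component b
  anchors-transport {a} {b} {p} same p∈A = witness (ā p ∈? component b) (begin
    does (ā p ∈? component b) ≡⟨ lookup∘tabulate _ p ⟨
    lookup (anchors b) p      ≡⟨ cong (λ S → lookup S p) same ⟨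
    lookup (anchors a) p      ≡⟨ lookup∘tabulate _ p ⟩
    does (ā p ∈? component a) ≡⟨ dec-true (ā p ∈? component a) p∈A ⟩
    true                      ∎)
    where open ≡-Reasoning

  module Shortening {u v d} (D : Decomposition u v d) where
    open Decomposition D

    shortcut : ∀ {i j c} → c + i < j → j ≤ d → Path (e i) (s j) c → Shorter u v d
    shortcut {i} {j} {c} c+i<j j≤d jump =
      _ , shortcut-bound {i} {j} {c} c+i<j j≤d , append (prefix i≤d) (append jump (suffix j≤d))
      where i≤d = ≤-trans (m≤n+m i c) (≤-trans (<⇒≤ c+i<j) j≤d)

    NoReturn : Set
    NoReturn = ∀ {i j} → i < j → j ≤ d → s j ∉ component (e i)

    separated : NoReturn → ∀ {i j} → i < j → j ≤ d → ¬ Reach (e i) (e j)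
    separated no-return i<j j≤d ei→ej = no-return i<j j≤d (reach⇒component (ei→ej ◅◅ reach-sym (segment j≤d)))

    -- Without returns, two equally labelled segment ends e i, e j lie in distinct
    -- parameter-free components; exchanging them turns bridge j into a new edge
    -- from e i, which skips all bridges from i to j.
    repeated-label : NoReturn → ∀ {i j} → i < j → j < d → label (e i) ≡ label (e j) →
                     Shorter u v d
    repeated-label no-return {i} {j} i<j j<d same with any? (λ p → ā p ∈? component (e i))
    ... | yes (p , p∈Ai) = ⊥-elim (separated no-return i<j (<⇒≤ j<d)
            (component⇒reach p∈Ai ◅◅ reach-sym (component⇒reach (anchors-transport (cong proj₁ same) p∈Ai))))
    ... | no unanchored = shortcut (s≤s i<j) j<d (newE (inj₂ φ-at-i) not-old stop)
      where
      c = s (suc j)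
      c∉Ai : c ∉ component (e i)
      c∉Ai = no-return (m<n⇒m<1+n i<j) j<d
      avoids-j : ∀ l → extend c ā l ∉ component (e j)
      avoids-j zero    = no-return (n<1+n j) j<d
      avoids-j (suc p) = unanchored ∘ (p ,_) ∘ anchors-transport (sym (cong proj₁ same))
      avoids-i : ∀ l → extend c ā l ∉ component (e i)
      avoids-i zero    = c∉Ai
      avoids-i (suc p) = unanchored ∘ (p ,_)
      φ-at-j : Sat G φ (extend (e j) (extend c ā))
      φ-at-j with bridge j<d
      ... | inj₁ old , new = ⊥-elim (new old)
      ... | inj₂ φ-holds , _ = φ-holds
      φ-at-i : Sat G φ (extend (e i) (extend c ā))
      φ-at-i = component-exchange φ (extend c ā) ≤-refl
        (separated no-return i<j (<⇒≤ j<d) ∘ reach-sym) avoids-j avoids-i (sym (cong proj₂ same)) φ-at-j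
      not-old : ¬ Edge G (e i) c
      not-old old = c∉Ai (component-closed (e i) (∈-component (e i)) old)

    -- A path with more bridges than there are labels can be shortened: either some
    -- segment returns to an earlier component, or two segment ends share a label.
    shorten : label-count φ < d → Shorter u v d
    shorten many with anyUpTo? (λ j → anyUpTo? (λ i → s j ∈? component (e i)) j) (suc d)
    ... | yes (j , s≤s j≤d , i , i<j , sj∈Ai) = shortcut i<j j≤d (reach-path (component⇒reach sj∈Ai))
    ... | no no-shortcut
      with i , j , i<j , same-code ← pigeonhole many (λ (i : Fin d) → code (label-finite k (rank φ)) (label (e (toℕ i))))
      = repeated-label no-return i<j (toℕ<n j) (code-injective (label-finite k (rank φ)) same-code)
      where
      no-return : NoReturn
      no-return {i} {j} i<j j≤d sj∈Ai = no-shortcut (j , s≤s j≤d , i , i<j , sj∈Ai)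

  bounded : ∀ {u v} d → Path u v d → Short u v
  bounded {u} {v} = <-rec (λ d → Path u v d → Short u v) step
    where
    step : ∀ d → (∀ {d′} → d′ < d → Path u v d′ → Short u v) → Path u v d → Short u v
    step d shorter path with d ≤? label-count φ
    ... | yes few = d , few , path
    ... | no many = let (d′ , d′<d , path′) = Shortening.shorten (decompose path) (≰⇒> many) in shorter d′<d path′

lemma4 : (k : ℕ) (φ : InsertionQuery k) →
    ∃ λ (m : ℕ) →
    (G : Graph) → Undirected G → (ā : Fin k → Node G) → (u v : Node G) →
    ConnectedIn φ G ā u v →
    ∃ λ (d : ℕ) → d ≤ m × BridgePath φ G ā u v d
lemma4 k φ = label-count φ , λ G undirected ā u v (d , path) →
  Bridges.bounded φ G undirected ā d path
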